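{- The calculus $\mathbf{L}^{\Lambda}_{\backslash,/}\wedge$ is strongly complete with respect to the class of square R-models: for every set $\mathcal{H}$ of sequents and every sequent $\Pi\to B$ in the language of $\backslash,/,\wedge$, if $\Pi\to B$ is true in every square R-model in which all sequents of $\mathcal{H}$ are true, then $\Pi\to B$ is derivable from $\mathcal{H}$ in $\mathbf{L}^{\Lambda}_{\backslash,/}\wedge$.
   Context: Formulae are built from a countable set of propositional variables using the binary connectives $\backslash$, $/$, $\wedge$. A sequent is $\Pi \to B$ with $B$ a formula and $\Pi$ a finite, possibly empty, sequence of formulae (empty sequence written $\Lambda$). The calculus $\mathbf{L}^{\Lambda}_{\backslash,/}\wedge$ has axiom $A\to A$ and rules (capital Greek letters denote possibly empty sequences): (Cut) from $\Pi \to A$ and $\Gamma, A, \Delta \to C$ infer $\Gamma,\Pi,\Delta\to C$; ($\backslash L$) from $\Pi\to A$ and $\Gamma,B,\Delta\to C$ infer $\Gamma,\Pi,A\backslash B,\Delta\to C$; ($\backslash R$) from $A,\Pi\to B$ infer $\Pi\to A\backslash B$; ($/ L$) from $\Pi\to A$ and $\Gamma,B,\Delta\to C$ infer $\Gamma,B/A,\Pi,\Delta\to C$; ($/R$) from $\Pi,A\to B$ infer $\Pi\to B/A$; ($\wedge L$) from $\Gamma,A,\Delta\to C$ infer both $\Gamma,A\wedge B,\Delta\to C$ and $\Gamma,B\wedge A,\Delta\to C$; ($\wedge R$) from $\Pi\to A$ and $\Pi\to B$ infer $\Pi\to A\wedge B$. A sequent is derivable from a set of sequents $\mathcal H$ if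 it is derivable when the sequents of $\mathcal H$ are added as extra axioms. For binary relations $R,S$ on a non-empty set $W$: $R\circ S=\{(x,z) \mid \exists y\,((x,y)\in R, (y,z)\in S)\}$; $R\backslash S=\{(y,z)\in W\times W \mid \forall x\,((x,y)\in R\Rightarrow (x,z)\in S)\}$; $S/R=\{(x,y)\in W\times W \mid \forall z\,((y,z)\in R\Rightarrow(x,z)\in S)\}$; $\delta=\{(x,x)\mid x\in W\}$. A square R-model is a pair $(W,v)$ with $W$ non-empty and $v$ assigning to each formula a binary relation on $W$ such that $v(A\backslash B)=v(A)\backslash v(B)$, $v(B/A)=v(B)/v(A)$, $v(A\wedge B)=v(A)\cap v(B)$. A sequent $A_1,\ldots,A_n\to B$ ($n\ge1$) is true in the model if $v(A_1)\circ\cdots\circ v(A_n)\subseteq v(B)$, and $\Lambda\to B$ is true if $\delta\subseteq v(B)$. -}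

module Defs where

open import Level using (Level; 0ℓ) renaming (suc to lsuc)
open import Data.Nat using (ℕ)
open import Data.List using (List; []; _∷_; _++_)
open import Data.Product using (Σ; _×_; _,_)
open import Relation.Binary.PropositionalEquality using (_≡_)

infixr 30 _⧵_
infixl 30 _⧸_
infixr 35 _∧_
data Formula : Set where
  var : ℕ → Formula
  _⧵_ : Formula → Formula → Formula
  _⧸_ : Formula → Formula → Formula
  _∧_ : Formula → Formula → Formula

infix 10 _⇒_
record Sequent : Set where
  constructor _⇒_
  field
    ant : List Formula
    suc : Formula
open Sequent public

SequentSet : Set₁
SequentSet = Sequent → Set

data Derivable (H : SequentSet) : Sequent → Set where
  hyp   : ∀ {s} → H s → Derivable H s
  ax    : ∀ A → Derivable H ((A ∷ []) ⇒ A)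
  cut   : ∀ {Π Γ Δ A C} → Derivable H (Π ⇒ A) → Derivable H ((Γ ++ A ∷ Δ) ⇒ C)
        → Derivable H ((Γ ++ Π ++ Δ) ⇒ C)
  ⧵L    : ∀ {Π Γ Δ A B C} → Derivable H (Π ⇒ A) → Derivable H ((Γ ++ B ∷ Δ) ⇒ C)
        → Derivable H ((Γ ++ Π ++ (A ⧵ B) ∷ Δ) ⇒ C)
  ⧵R    : ∀ {Π A B} → Derivable H ((A ∷ Π) ⇒ B) → Derivable H (Π ⇒ (A ⧵ B))
  ⧸L    : ∀ {Π Γ Δ A B C} → Derivable H (Π ⇒ A) → Derivable H ((Γ ++ B ∷ Δ) ⇒ C)
        → Derivable H ((Γ ++ (B ⧸ A) ∷ Π ++ Δ) ⇒ C)
  ⧸R    : ∀ {Π A B} → Derivable H ((Π ++ A ∷ []) ⇒ B) → Derivable H (Π ⇒ (B ⧸ A))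
  ∧L₁   : ∀ {Γ Δ A B C} → Derivable H ((Γ ++ A ∷ Δ) ⇒ C)
        → Derivable H ((Γ ++ (A ∧ B) ∷ Δ) ⇒ C)
  ∧L₂   : ∀ {Γ Δ A B C} → Derivable H ((Γ ++ A ∷ Δ) ⇒ C)
        → Derivable H ((Γ ++ (B ∧ A) ∷ Δ) ⇒ C)
  ∧R    : ∀ {Π A B} → Derivable H (Π ⇒ A) → Derivable H (Π ⇒ B)
        → Derivable H (Π ⇒ (A ∧ B))

Rel₂ : Set → Set₁
Rel₂ W = W → W → Set

module _ {W : Set} where
  _∘ʳ_ : Rel₂ W → Rel₂ W → Rel₂ W
  (R ∘ʳ S) x z = Σ W λ y → R x y × S y z

  _⧵ʳ_ : Rel₂ W → Rel₂ W → Rel₂ W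
  (R ⧵ʳ S) y z = ∀ x → R x y → S x z

  _⧸ʳ_ : Rel₂ W → Rel₂ W → Rel₂ W
  (S ⧸ʳ R) x y = ∀ z → R y z → S x z

  _∩ʳ_ : Rel₂ W → Rel₂ W → Rel₂ W
  (R ∩ʳ S) x y = R x y × S x y

  δ : Rel₂ W
  δ x y = x ≡ y

  _⊆ʳ_ : Rel₂ W → Rel₂ W → Set
  R ⊆ʳ S = ∀ x y → R x y → S x y

record SquareRModel : Set₁ where
  field
    W      : Set
    point  : W                -- non-emptiness
    val    : ℕ → Rel₂ W

  v : Formula → Rel₂ W
  v (var p) = val p
  v (A ⧵ B) = (v A) ⧵ʳ (v B)
  v (B ⧸ A) = (v B) ⧸ʳ (v A)
  v (A ∧ B) = (v A) ∩ʳ (v B)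

  comp : Formula → List Formula → Rel₂ W
  comp A []       = v A
  comp A (B ∷ Γ)  = (v A) ∘ʳ (comp B Γ)

  TrueIn : Sequent → Set
  TrueIn ([] ⇒ B)      = δ ⊆ʳ v B
  TrueIn ((A ∷ Π) ⇒ B) = comp A Π ⊆ʳ v B

_⊨_ : SequentSet → Sequent → Set₁
H ⊨ s = (M : SquareRModel) → (∀ t → H t → SquareRModel.TrueIn M t)
      → SquareRModel.TrueIn M s

-- The canonical model lives in the free group on the formulae: a pair (x , y) of group
-- elements belongs to v(C) iff y = x · Γ for some Γ with Γ ⊢ C, where a list of formulae
-- is read as the product of its members. Positive words are reduced, so x · Γ = x · Π
-- forces Γ = Π, and the truth lemma at the pair (1 , Π) gives completeness. For A \ B
-- the definition of v is tested at the two points y · A⁻¹ and y · (A ∧ A)⁻¹, both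
-- v(A)-related to y; since A ≠ A ∧ A, the two resulting words can only agree when the
-- antecedent obtained at the first point begins with A. The case B / A is dual.
module Submission where

open import Defs
open import Data.Empty using (⊥-elim)
open import Data.List using (List; []; _∷_; _++_; _∷ʳ_; foldl; foldr; map; reverse; _ʳ++_)
open import Data.List.Properties
  using (foldl-++; ++-assoc; ++-identityʳ; map-++; ++-ʳ++; map-injective; reverse-injective; ∷-injectiveˡ)
open import Data.List.Relation.Unary.Linked as Linked using (Linked; []; [-]; _∷_)
open import Data.List.Reverse using (reverseView; []; _∶_∶ʳ_)
import Data.Nat as ℕ
open import Data.Product using (Σ; ∃; _×_; _,_; proj₂)
open import Data.Sum using (_⊎_; inj₁; inj₂; map₁)
open import Function using (_∘_; flip)
open import Relation.Nullary using (Dec; yes; no)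
open import Relation.Nullary.Decidable using (map′; _×-dec_)
open import Relation.Binary.PropositionalEquality

infix 4 _≟_ _≟ᴸ_ _≈_
infixl 6 _·_

_≟_ : (A B : Formula) → Dec (A ≡ B)
var m ≟ var n = map′ (cong var) (λ { refl → refl }) (m ℕ.≟ n)
(A ⧵ B) ≟ (C ⧵ D) = map′ (λ (p , q) → cong₂ _⧵_ p q) (λ { refl → refl , refl }) (A ≟ C ×-dec B ≟ D)
(A ⧸ B) ≟ (C ⧸ D) = map′ (λ (p , q) → cong₂ _⧸_ p q) (λ { refl → refl , refl }) (A ≟ C ×-dec B ≟ D)
(A ∧ B) ≟ (C ∧ D) = map′ (λ (p , q) → cong₂ _∧_ p q) (λ { refl → refl , refl }) (A ≟ C ×-dec B ≟ D)
var _ ≟ (_ ⧵ _) = no λ ()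
var _ ≟ (_ ⧸ _) = no λ ()
var _ ≟ (_ ∧ _) = no λ ()
(_ ⧵ _) ≟ var _ = no λ ()
(_ ⧵ _) ≟ (_ ⧸ _) = no λ ()
(_ ⧵ _) ≟ (_ ∧ _) = no λ ()
(_ ⧸ _) ≟ var _ = no λ ()
(_ ⧸ _) ≟ (_ ⧵ _) = no λ ()
(_ ⧸ _) ≟ (_ ∧ _) = no λ ()
(_ ∧ _) ≟ var _ = no λ ()
(_ ∧ _) ≟ (_ ⧵ _) = no λ ()
(_ ∧ _) ≟ (_ ⧸ _) = no λ ()

A≢A∧B : ∀ A B → A ≢ A ∧ B
A≢A∧B (A ∧ B) C eq = A≢A∧B A B (cong leftConjunct eq)
  where
  leftConjunct : Formula → Formula
  leftConjunct (D ∧ _) = D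
  leftConjunct D = D

-- Free reduction

data Letter : Set where
  pos neg : Formula → Letter

inv : Letter → Letter
inv (pos A) = neg A
inv (neg A) = pos A

inv-involutive : ∀ l → inv (inv l) ≡ l
inv-involutive (pos _) = refl
inv-involutive (neg _) = refl

_≟ᴸ_ : (a b : Letter) → Dec (a ≡ b)
pos A ≟ᴸ pos B = map′ (cong pos) (λ { refl → refl }) (A ≟ B)
neg A ≟ᴸ neg B = map′ (cong neg) (λ { refl → refl }) (A ≟ B)
pos _ ≟ᴸ neg _ = no λ ()
neg _ ≟ᴸ pos _ = no λ ()

Reduced : List Letter → Set
Reduced = Linked (λ a b → a ≢ inv b)

-- Reduced words are stored reversed, so that appending a letter acts on the head.
push : List Letter → Letter → List Letter
push [] l = l ∷ []
push (h ∷ s) l with h ≟ᴸ inv l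
... | yes _ = s
... | no _ = l ∷ h ∷ s

push-cancel : ∀ {h s l} → h ≡ inv l → push (h ∷ s) l ≡ s
push-cancel {h} {s} {l} h≡ with h ≟ᴸ inv l
... | yes _ = refl
... | no h≢ = ⊥-elim (h≢ h≡)

push-keep : ∀ {h s l} → h ≢ inv l → push (h ∷ s) l ≡ l ∷ h ∷ s
push-keep {h} {s} {l} h≢ with h ≟ᴸ inv l
... | yes h≡ = ⊥-elim (h≢ h≡)
... | no _ = refl

push-reduced : ∀ {s} l → Reduced s → Reduced (push s l)
push-reduced {[]} l _ = [-]
push-reduced {h ∷ s} l r with h ≟ᴸ inv l
... | yes _ = Linked.tail r
... | no h≢ = (λ l≡ → h≢ (trans (sym (inv-involutive h)) (cong inv (sym l≡)))) ∷ r

push-push-inv : ∀ {s} l → Reduced s → push (push s l) (inv l) ≡ s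
push-push-inv {[]} l _ = push-cancel (sym (inv-involutive l))
push-push-inv {h ∷ s} l r with h ≟ᴸ inv l
push-push-inv {h ∷ s} l r | no _ = push-cancel (sym (inv-involutive l))
push-push-inv {_ ∷ []} l r | yes refl = refl
push-push-inv {_ ∷ h′ ∷ s} l (h≢ ∷ _) | yes refl =
  push-keep λ h′≡ → h≢ (sym (trans (cong inv h′≡) (inv-involutive (inv l))))

push-inv-push : ∀ {s} l → Reduced s → push (push s (inv l)) l ≡ s
push-inv-push {s} l r = subst (λ l′ → push (push s (inv l)) l′ ≡ s) (inv-involutive l) (push-push-inv (inv l) r)

foldl-push-reduced : ∀ {s} w → Reduced s → Reduced (foldl push s w)
foldl-push-reduced [] r = r
foldl-push-reduced (l ∷ w) r = foldl-push-reduced w (push-reduced l r)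

normalize : List Letter → List Letter
normalize = foldl push []

normalize-reduced : ∀ w → Reduced (normalize w)
normalize-reduced w = foldl-push-reduced w []

normalize-++ : ∀ u w → normalize (u ++ w) ≡ foldl push (normalize u) w
normalize-++ = foldl-++ push []

_⋆_ : List Letter → List Letter → List Letter
s ⋆ r = foldr (flip push) s r

⋆-reduced : ∀ {s} r → Reduced s → Reduced (s ⋆ r)
⋆-reduced [] rs = rs
⋆-reduced (h ∷ r) rs = push-reduced h (⋆-reduced r rs)

push-⋆ : ∀ {s} r l → Reduced s → push (s ⋆ r) l ≡ s ⋆ push r l
push-⋆ [] l rs = refl
push-⋆ (h ∷ r) l rs with h ≟ᴸ inv l
... | yes refl = push-inv-push l (⋆-reduced r rs)
... | no _ = refl

foldl-push-⋆ : ∀ {s} w r → Reduced s → foldl push (s ⋆ r) w ≡ s ⋆ foldl push r w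
foldl-push-⋆ [] r rs = refl
foldl-push-⋆ (l ∷ w) r rs =
  trans (cong (λ t → foldl push t w) (push-⋆ r l rs)) (foldl-push-⋆ w (push r l) rs)

record _≈_ (u w : List Letter) : Set where
  constructor mk≈
  field normal : normalize u ≡ normalize w
open _≈_

≈-reflexive : ∀ {u w} → u ≡ w → u ≈ w
≈-reflexive eq = mk≈ (cong normalize eq)

≈-refl : ∀ {u} → u ≈ u
≈-refl = mk≈ refl

≈-sym : ∀ {u w} → u ≈ w → w ≈ u
≈-sym (mk≈ eq) = mk≈ (sym eq)

≈-trans : ∀ {u w z} → u ≈ w → w ≈ z → u ≈ z
≈-trans (mk≈ eq) (mk≈ eq′) = mk≈ (trans eq eq′)

≈-++ʳ : ∀ {u w} z → u ≈ w → u ++ z ≈ w ++ z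
≈-++ʳ {u} {w} z (mk≈ eq) =
  mk≈ (trans (normalize-++ u z) (trans (cong (λ t → foldl push t z) eq) (sym (normalize-++ w z))))

≈-cancel : ∀ y l w → (y ++ l ∷ []) ++ inv l ∷ w ≈ y ++ w
≈-cancel y l w = mk≈ (begin
    normalize ((y ++ l ∷ []) ++ inv l ∷ w)
      ≡⟨ normalize-++ (y ++ l ∷ []) (inv l ∷ w) ⟩
    foldl push (normalize (y ++ l ∷ [])) (inv l ∷ w)
      ≡⟨ cong (λ t → foldl push (push t (inv l)) w) (normalize-++ y (l ∷ [])) ⟩
    foldl push (push (push (normalize y) l) (inv l)) w
      ≡⟨ cong (λ t → foldl push t w) (push-push-inv l (normalize-reduced y)) ⟩
    foldl push (normalize y) w
      ≡⟨ normalize-++ y w ⟨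
    normalize (y ++ w) ∎)
  where open ≡-Reasoning

≈-cancel-end : ∀ y l → (y ++ l ∷ []) ++ inv l ∷ [] ≈ y
≈-cancel-end y l = ≈-trans (≈-cancel y l []) (≈-reflexive (++-identityʳ y))

≈-cancelʳ : ∀ {u w l} → u ++ l ∷ [] ≈ w ++ l ∷ [] → u ≈ w
≈-cancelʳ {u} {w} {l} eq =
  ≈-trans (≈-sym (≈-cancel-end u l)) (≈-trans (≈-++ʳ (inv l ∷ []) eq) (≈-cancel-end w l))

inverse : List Letter → List Letter
inverse [] = []
inverse (l ∷ w) = inverse w ++ inv l ∷ []

inverse-++-≈ : ∀ w → inverse w ++ w ≈ []
inverse-++-≈ [] = ≈-refl
inverse-++-≈ (l ∷ w) =
  ≈-trans (≈-reflexive (cong (λ l′ → (inverse w ++ inv l ∷ []) ++ l′ ∷ w) (sym (inv-involutive l))))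
    (≈-trans (≈-cancel (inverse w) (inv l) w) (inverse-++-≈ w))

normalize-inverse-++ : ∀ y u → normalize u ≡ normalize (inverse y) ⋆ normalize (y ++ u)
normalize-inverse-++ y u = begin
  foldl push [] u                                ≡⟨ cong (λ t → foldl push t u) (normal (inverse-++-≈ y)) ⟨
  foldl push (normalize (inverse y ++ y)) u      ≡⟨ normalize-++ (inverse y ++ y) u ⟨
  normalize ((inverse y ++ y) ++ u)              ≡⟨ cong normalize (++-assoc (inverse y) y u) ⟩
  normalize (inverse y ++ y ++ u)                ≡⟨ normalize-++ (inverse y) (y ++ u) ⟩
  foldl push (normalize (inverse y)) (y ++ u)    ≡⟨ foldl-push-⋆ (y ++ u) [] (normalize-reduced (inverse y)) ⟩
  normalize (inverse y) ⋆ normalize (y ++ u)     ∎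
  where open ≡-Reasoning

≈-cancelˡ : ∀ y {u w} → y ++ u ≈ y ++ w → u ≈ w
≈-cancelˡ y {u} {w} (mk≈ eq) =
  mk≈ (trans (normalize-inverse-++ y u) (trans (cong (normalize (inverse y) ⋆_) eq) (sym (normalize-inverse-++ y w))))

_·_ : List Letter → List Formula → List Letter
x · Γ = x ++ map pos Γ

·-++ : ∀ x Γ Δ → x · (Γ ++ Δ) ≡ x · Γ · Δ
·-++ x Γ Δ = trans (cong (x ++_) (map-++ pos Γ Δ)) (sym (++-assoc x (map pos Γ) (map pos Δ)))

·-trans : ∀ x {y z Γ Δ} → x · Γ ≈ y → y · Δ ≈ z → x · (Γ ++ Δ) ≈ z
·-trans x {Γ = Γ} {Δ} x·Γ≈y y·Δ≈z =
  ≈-trans (≈-reflexive (·-++ x Γ Δ)) (≈-trans (≈-++ʳ (map pos Δ) x·Γ≈y) y·Δ≈z)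

foldl-push-positive : ∀ Δ C s → foldl push (pos C ∷ s) (map pos Δ) ≡ map pos Δ ʳ++ pos C ∷ s
foldl-push-positive [] C s = refl
foldl-push-positive (D ∷ Δ) C s = foldl-push-positive Δ D (pos C ∷ s)

normalize-positive : ∀ Δ → normalize (map pos Δ) ≡ reverse (map pos Δ)
normalize-positive [] = refl
normalize-positive (C ∷ Δ) = foldl-push-positive Δ C []

·-injective : ∀ x {Γ Δ} → x · Γ ≈ x · Δ → Γ ≡ Δ
·-injective x {Γ} {Δ} eq =
  map-injective (λ { refl → refl })
    (reverse-injective (trans (sym (normalize-positive Γ)) (trans (normal (≈-cancelˡ x eq)) (normalize-positive Δ))))

negatives : List Letter → List Formula
negatives [] = []
negatives (pos _ ∷ w) = negatives w
negatives (neg C ∷ w) = C ∷ negatives w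

negatives-positive-ʳ++ : ∀ Δ s → negatives (map pos Δ ʳ++ s) ≡ negatives s
negatives-positive-ʳ++ [] s = refl
negatives-positive-ʳ++ (C ∷ Δ) s = negatives-positive-ʳ++ Δ (pos C ∷ s)

CancelsOrSurvives : Formula → List Formula → List Formula → List Letter → Set
CancelsOrSurvives D Δ Δ′ w = (Δ ≡ Δ′ × negatives (normalize w) ≡ []) ⊎ negatives (normalize w) ≡ D ∷ []

neg∷positive : ∀ D Δ → Σ (List Formula) λ Δ′ → CancelsOrSurvives D Δ (D ∷ Δ′) (neg D ∷ map pos Δ)
neg∷positive D [] = [] , inj₂ refl
neg∷positive D (C ∷ Δ) with C ≟ D
... | yes refl = Δ , inj₁ (refl , (begin
    negatives (foldl push (push (neg C ∷ []) (pos C)) (map pos Δ))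
      ≡⟨ cong (λ t → negatives (foldl push t (map pos Δ))) (push-cancel refl) ⟩
    negatives (normalize (map pos Δ))
      ≡⟨ cong negatives (normalize-positive Δ) ⟩
    negatives (map pos Δ ʳ++ [])
      ≡⟨ negatives-positive-ʳ++ Δ [] ⟩
    [] ∎))
  where open ≡-Reasoning
... | no C≢D = Δ , inj₂ (begin
    negatives (foldl push (push (neg D ∷ []) (pos C)) (map pos Δ))
      ≡⟨ cong (λ t → negatives (foldl push t (map pos Δ))) (push-keep λ { refl → C≢D refl }) ⟩
    negatives (foldl push (pos C ∷ neg D ∷ []) (map pos Δ))
      ≡⟨ cong negatives (foldl-push-positive Δ C (neg D ∷ [])) ⟩
    negatives (map pos Δ ʳ++ pos C ∷ neg D ∷ [])
      ≡⟨ negatives-positive-ʳ++ Δ (pos C ∷ neg D ∷ []) ⟩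
    D ∷ [] ∎)
  where open ≡-Reasoning

normalize-positive∷ʳneg : ∀ Δ C D →
  normalize (map pos (Δ ∷ʳ C) ++ neg D ∷ []) ≡ push (pos C ∷ reverse (map pos Δ)) (neg D)
normalize-positive∷ʳneg Δ C D = begin
  normalize (map pos (Δ ∷ʳ C) ++ neg D ∷ [])       ≡⟨ normalize-++ (map pos (Δ ∷ʳ C)) (neg D ∷ []) ⟩
  push (normalize (map pos (Δ ∷ʳ C))) (neg D)      ≡⟨ cong (λ t → push t (neg D)) (normalize-positive (Δ ∷ʳ C)) ⟩
  push (reverse (map pos (Δ ∷ʳ C))) (neg D)        ≡⟨ cong (λ t → push (t ʳ++ []) (neg D)) (map-++ pos Δ (C ∷ [])) ⟩
  push ((map pos Δ ++ pos C ∷ []) ʳ++ []) (neg D)  ≡⟨ cong (λ t → push t (neg D)) (++-ʳ++ (map pos Δ)) ⟩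
  push (pos C ∷ reverse (map pos Δ)) (neg D)       ∎
  where open ≡-Reasoning

positive∷ʳneg : ∀ D Δ → Σ (List Formula) λ Δ′ → CancelsOrSurvives D Δ (Δ′ ∷ʳ D) (map pos Δ ++ neg D ∷ [])
positive∷ʳneg D Δ with reverseView Δ
... | [] = [] , inj₂ refl
... | Δ′ ∶ _ ∶ʳ C with C ≟ D
...   | yes refl = Δ′ , inj₁ (refl , (begin
    negatives (normalize (map pos (Δ′ ∷ʳ C) ++ neg C ∷ []))
      ≡⟨ cong negatives (normalize-positive∷ʳneg Δ′ C C) ⟩
    negatives (push (pos C ∷ reverse (map pos Δ′)) (neg C))
      ≡⟨ cong negatives (push-cancel {s = reverse (map pos Δ′)} {neg C} refl) ⟩
    negatives (map pos Δ′ ʳ++ [])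
      ≡⟨ negatives-positive-ʳ++ Δ′ [] ⟩
    [] ∎))
  where open ≡-Reasoning
...   | no C≢D = Δ′ , inj₂ (begin
    negatives (normalize (map pos (Δ′ ∷ʳ C) ++ neg D ∷ []))
      ≡⟨ cong negatives (normalize-positive∷ʳneg Δ′ C D) ⟩
    negatives (push (pos C ∷ reverse (map pos Δ′)) (neg D))
      ≡⟨ cong negatives (push-keep {pos C} {reverse (map pos Δ′)} {neg D} λ { refl → C≢D refl }) ⟩
    D ∷ negatives (map pos Δ′ ʳ++ [])
      ≡⟨ cong (D ∷_) (negatives-positive-ʳ++ Δ′ []) ⟩
    D ∷ [] ∎)
  where open ≡-Reasoning

survivors-differ : ∀ {u w D E} → D ≢ E →
  negatives u ≡ D ∷ [] → negatives w ≡ [] ⊎ negatives w ≡ E ∷ [] → u ≢ w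
survivors-differ D≢E nu (inj₁ nw) refl with () ← trans (sym nu) nw
survivors-differ D≢E nu (inj₂ nw) refl = D≢E (∷-injectiveˡ (trans (sym nu) nw))

positive-quotientˡ : ∀ {D E Δ₁ Δ₂} → D ≢ E →
  neg D ∷ map pos Δ₁ ≈ neg E ∷ map pos Δ₂ → ∃ λ Δ → Δ₁ ≡ D ∷ Δ
positive-quotientˡ {D} {E} {Δ₁} {Δ₂} D≢E eq with neg∷positive D Δ₁
... | Δ , inj₁ (Δ₁≡ , _) = Δ , Δ₁≡
... | _ , inj₂ n₁ = ⊥-elim (survivors-differ D≢E n₁ (map₁ proj₂ (proj₂ (neg∷positive E Δ₂))) (normal eq))

positive-quotientʳ : ∀ {D E Δ₁ Δ₂} → D ≢ E →
  map pos Δ₁ ++ neg D ∷ [] ≈ map pos Δ₂ ++ neg E ∷ [] → ∃ λ Δ → Δ₁ ≡ Δ ∷ʳ D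
positive-quotientʳ {D} {E} {Δ₁} {Δ₂} D≢E eq with positive∷ʳneg D Δ₁
... | Δ , inj₁ (Δ₁≡ , _) = Δ , Δ₁≡
... | _ , inj₂ n₁ = ⊥-elim (survivors-differ D≢E n₁ (map₁ proj₂ (proj₂ (positive∷ʳneg E Δ₂))) (normal eq))

quotientˡ : ∀ y {z D E Δ₁ Δ₂} → D ≢ E →
  (y ++ neg D ∷ []) · Δ₁ ≈ z → (y ++ neg E ∷ []) · Δ₂ ≈ z → ∃ λ Δ → Δ₁ ≡ D ∷ Δ
quotientˡ y {D = D} {E} {Δ₁} {Δ₂} D≢E e₁ e₂ =
  positive-quotientˡ D≢E
    (≈-cancelˡ y (≈-trans (reassociate D Δ₁) (≈-trans e₁ (≈-sym (≈-trans (reassociate E Δ₂) e₂)))))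
  where
  reassociate : ∀ C Δ → y ++ neg C ∷ map pos Δ ≈ (y ++ neg C ∷ []) · Δ
  reassociate C Δ = ≈-reflexive (sym (++-assoc y (neg C ∷ []) (map pos Δ)))

quotientʳ : ∀ x y {D E Δ₁ Δ₂} → D ≢ E →
  x · Δ₁ ≈ y ++ pos D ∷ [] → x · Δ₂ ≈ y ++ pos E ∷ [] → ∃ λ Δ → Δ₁ ≡ Δ ∷ʳ D
quotientʳ x y {D} {E} {Δ₁} {Δ₂} D≢E e₁ e₂ =
  positive-quotientʳ D≢E (≈-cancelˡ x (≈-trans (divide D Δ₁ e₁) (≈-sym (divide E Δ₂ e₂))))
  where
  divide : ∀ C Δ → x · Δ ≈ y ++ pos C ∷ [] → x ++ map pos Δ ++ neg C ∷ [] ≈ y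
  divide C Δ e = ≈-trans (≈-reflexive (sym (++-assoc x (map pos Δ) (neg C ∷ []))))
                         (≈-trans (≈-++ʳ (neg C ∷ []) e) (≈-cancel-end y (pos C)))

module DerivedRules (H : SequentSet) where

  infix 4 ⊢_

  ⊢_ : Sequent → Set
  ⊢ s = Derivable H s

  ∧-fst : ∀ A B → ⊢ ((A ∧ B) ∷ []) ⇒ A
  ∧-fst A B = ∧L₁ {Γ = []} {Δ = []} (ax A)

  ∧-snd : ∀ A B → ⊢ ((A ∧ B) ∷ []) ⇒ B
  ∧-snd A B = ∧L₂ {Γ = []} {Δ = []} (ax B)

  cut-end : ∀ {Ξ Γ A C} → ⊢ Γ ⇒ A → ⊢ (Ξ ++ A ∷ []) ⇒ C → ⊢ (Ξ ++ Γ) ⇒ C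
  cut-end {Ξ} {Γ} {C = C} d e = subst (λ Σ → ⊢ (Ξ ++ Σ) ⇒ C) (++-identityʳ Γ) (cut {Γ = Ξ} {Δ = []} d e)

  cut-single : ∀ {Γ A C} → ⊢ Γ ⇒ A → ⊢ (A ∷ []) ⇒ C → ⊢ Γ ⇒ C
  cut-single = cut-end {Ξ = []}

  ⧵-elim : ∀ {Γ Δ A B} → ⊢ Γ ⇒ A → ⊢ Δ ⇒ A ⧵ B → ⊢ (Γ ++ Δ) ⇒ B
  ⧵-elim {Γ} {B = B} dA d = cut-end {Ξ = Γ} d (⧵L {Γ = []} {Δ = []} dA (ax B))

  ⧸-elim : ∀ {Γ Δ A B} → ⊢ Δ ⇒ B ⧸ A → ⊢ Γ ⇒ A → ⊢ (Δ ++ Γ) ⇒ B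
  ⧸-elim {Γ} {Δ} {B = B} d dA =
    subst (λ Σ → ⊢ (Δ ++ Σ) ⇒ B) (++-identityʳ Γ)
      (cut {Γ = []} {Δ = Γ ++ []} d (⧸L {Γ = []} {Δ = []} dA (ax B)))

  Replaces : List Formula → List Formula → Set
  Replaces Γ Π = ∀ Ξ C → ⊢ (Ξ ++ Π) ⇒ C → ⊢ (Ξ ++ Γ) ⇒ C

  replaces-single : ∀ {Γ A} → ⊢ Γ ⇒ A → Replaces Γ (A ∷ [])
  replaces-single d Ξ C = cut-end {Ξ = Ξ} d

  replaces-∷ : ∀ {Γ Γ′ A Π} → ⊢ Γ ⇒ A → Replaces Γ′ Π → Replaces (Γ ++ Γ′) (A ∷ Π)
  replaces-∷ {Γ} {Γ′} {Π = Π} d r Ξ C e =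
    subst (λ Σ → ⊢ Σ ⇒ C) (++-assoc Ξ Γ Γ′)
      (r (Ξ ++ Γ) C (subst (λ Σ → ⊢ Σ ⇒ C) (sym (++-assoc Ξ Γ Π)) (cut {Γ = Ξ} {Δ = Π} d e)))

-- The canonical model

module CanonicalModel (H : SequentSet) where

  open DerivedRules H

  Witnessed : Formula → Rel₂ (List Letter)
  Witnessed C x y = Σ (List Formula) λ Γ → ⊢ Γ ⇒ C × x · Γ ≈ y

  model : SquareRModel
  model = record { W = List Letter ; point = [] ; val = Witnessed ∘ var }

  open SquareRModel model using (v; comp; TrueIn)

  ∧-witnessed⁺ : ∀ {A B} → (Witnessed A ∩ʳ Witnessed B) ⊆ʳ Witnessed (A ∧ B)
  ∧-witnessed⁺ x y ((Γ , dA , eA) , (Γ′ , dB , eB)) with ·-injective x (≈-trans eA (≈-sym eB))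
  ... | refl = Γ , ∧R dA dB , eA

  ∧-witnessed⁻ : ∀ {A B} → Witnessed (A ∧ B) ⊆ʳ (Witnessed A ∩ʳ Witnessed B)
  ∧-witnessed⁻ {A} {B} x y (Γ , d , e) = (Γ , cut-single d (∧-fst A B) , e) , (Γ , cut-single d (∧-snd A B) , e)

  ⧵-witnessed⁺ : ∀ {A B} → (Witnessed A ⧵ʳ Witnessed B) ⊆ʳ Witnessed (A ⧵ B)
  ⧵-witnessed⁺ {A} y z f
    with f (y ++ neg A ∷ []) (A ∷ [] , ax A , ≈-cancel-end y (neg A))
       | f (y ++ neg (A ∧ A) ∷ []) ((A ∧ A) ∷ [] , ∧-fst A A , ≈-cancel-end y (neg (A ∧ A)))
  ... | Δ₁ , d₁ , e₁ | _ , _ , e₂ with quotientˡ y (A≢A∧B A A) e₁ e₂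
  ... | Δ , refl = Δ , ⧵R d₁ , ≈-trans (≈-sym (≈-cancel y (neg A) (map pos Δ))) e₁

  ⧵-witnessed⁻ : ∀ {A B} → Witnessed (A ⧵ B) ⊆ʳ (Witnessed A ⧵ʳ Witnessed B)
  ⧵-witnessed⁻ y z (Δ , d , e) x (Γ , dA , eA) = Γ ++ Δ , ⧵-elim dA d , ·-trans x eA e

  ⧸-witnessed⁺ : ∀ {A B} → (Witnessed B ⧸ʳ Witnessed A) ⊆ʳ Witnessed (B ⧸ A)
  ⧸-witnessed⁺ {A} x y f
    with f (y ++ pos A ∷ []) (A ∷ [] , ax A , ≈-refl)
       | f (y ++ pos (A ∧ A) ∷ []) ((A ∧ A) ∷ [] , ∧-fst A A , ≈-refl)
  ... | Δ₁ , d₁ , e₁ | _ , _ , e₂ with quotientʳ x y (A≢A∧B A A) e₁ e₂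
  ... | Δ , refl = Δ , ⧸R d₁ , ≈-cancelʳ (≈-trans (≈-reflexive (sym (·-++ x Δ (A ∷ [])))) e₁)

  ⧸-witnessed⁻ : ∀ {A B} → Witnessed (B ⧸ A) ⊆ʳ (Witnessed B ⧸ʳ Witnessed A)
  ⧸-witnessed⁻ x y (Δ , d , e) z (Γ , dA , eA) = Δ ++ Γ , ⧸-elim d dA , ·-trans x e eA

  v⊆witnessed : ∀ C → v C ⊆ʳ Witnessed C
  witnessed⊆v : ∀ C → Witnessed C ⊆ʳ v C

  v⊆witnessed (var p) x y w = w
  v⊆witnessed (A ∧ B) x y (a , b) = ∧-witnessed⁺ x y (v⊆witnessed A x y a , v⊆witnessed B x y b)
  v⊆witnessed (A ⧵ B) y z f = ⧵-witnessed⁺ y z λ x w → v⊆witnessed B x z (f x (witnessed⊆v A x y w))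
  v⊆witnessed (B ⧸ A) x y f = ⧸-witnessed⁺ x y λ z w → v⊆witnessed B x z (f z (witnessed⊆v A y z w))

  witnessed⊆v (var p) x y w = w
  witnessed⊆v (A ∧ B) x y w with ∧-witnessed⁻ x y w
  ... | wA , wB = witnessed⊆v A x y wA , witnessed⊆v B x y wB
  witnessed⊆v (A ⧵ B) y z w x a = witnessed⊆v B x z (⧵-witnessed⁻ y z w x (v⊆witnessed A x y a))
  witnessed⊆v (B ⧸ A) x y w z a = witnessed⊆v B x z (⧸-witnessed⁻ x y w z (v⊆witnessed A y z a))

  comp-witnessed : ∀ A Π x y → comp A Π x y → Σ (List Formula) λ Γ → x · Γ ≈ y × Replaces Γ (A ∷ Π)
  comp-witnessed A [] x y a with v⊆witnessed A x y a
  ... | Γ , d , e = Γ , e , replaces-single d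
  comp-witnessed A (B ∷ Π) x y (w , a , c) with v⊆witnessed A x w a | comp-witnessed B Π w y c
  ... | Γ , d , e | Γ′ , e′ , r = Γ ++ Γ′ , ·-trans x e e′ , replaces-∷ d r

  comp-path : ∀ A Π x → comp A Π x (x · (A ∷ Π))
  comp-path A [] x = witnessed⊆v A x _ (A ∷ [] , ax A , ≈-refl)
  comp-path A (B ∷ Π) x =
    x · (A ∷ []) , witnessed⊆v A x _ (A ∷ [] , ax A , ≈-refl) ,
    subst (comp B Π _) (sym (·-++ x (A ∷ []) (B ∷ Π))) (comp-path B Π (x · (A ∷ [])))

  hypotheses-true : ∀ s → H s → TrueIn s
  hypotheses-true ([] ⇒ C) h x _ refl = witnessed⊆v C x x ([] , hyp h , ≈-reflexive (++-identityʳ x))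
  hypotheses-true ((A ∷ Π) ⇒ C) h x y c with comp-witnessed A Π x y c
  ... | Γ , e , r = witnessed⊆v C x y (Γ , r [] C (hyp h) , e)

  true-at-path : ∀ Π {B} → TrueIn (Π ⇒ B) → v B [] (map pos Π)
  true-at-path [] t = t [] [] refl
  true-at-path (A ∷ Π) t = t [] _ (comp-path A Π [])

  derivable-at-path : ∀ {Π B} → Witnessed B [] (map pos Π) → ⊢ Π ⇒ B
  derivable-at-path (Γ , d , e) with ·-injective [] e
  ... | refl = d

theorem7p6 : (H : SequentSet) (Π : List Formula) (B : Formula) → H ⊨ (Π ⇒ B) → Derivable H (Π ⇒ B)
theorem7p6 H Π B ⊨Π⇒B =
  derivable-at-path (v⊆witnessed B [] (map pos Π) (true-at-path Π (⊨Π⇒B model hypotheses-true)))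
  where open CanonicalModel H
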